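{- Let $G=(K\cup I,E)$ be a split graph and $(V,\mathcal{F})$ the split graph vertex shelling antimatroid defined on $G$. Let $i\in I$. Then for every $i$-feasible set $F\in\mathcal{F}$ we have $\operatorname{fos}(i)\subseteq F$.
   Context: All graphs are finite and simple. A split graph $G=(K\cup I,E)$ has vertex set $V=K\cup I$ partitioned into a clique $K$ and an independent set $I$ (either may be empty), the partition being given. For $S\subseteq V$, $N(S)$ is the set of vertices of $V\setminus S$ adjacent to some vertex of $S$; $N(v)=N(\{v\})$. A vertex is simplicial if its neighbours induce a clique. The split graph vertex shelling antimatroid $(V,\mathcal{F})$ on $G$: $F\subseteq V$ is feasible iff there is an ordering $(f_1,\dots,f_{|F|})$ of $F$ such that each $f_j$ is simplicial in $G\setminus\{f_1,\dots,f_{j-1}\}$. For $i\in I$, a feasible set $F$ is $i$-feasible if $i\in N(F)$. The forced set of $i\in I$ is $\operatorname{fos}(i)=\{k\in K: k \text{ not adjacent to } i\}\cup\{i'\in I: N(i')\not\subseteq N(i)\}$. -}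

module Defs where

open import Data.Nat using (ℕ)
open import Data.Fin using (Fin)
open import Data.Bool using (Bool; true; false)
open import Data.List using (List; []; _∷_)
open import Data.List.Membership.Propositional using () renaming (_∈_ to _∈ˡ_)
open import Data.Product using (Σ; ∃; _×_)
open import Data.Unit using (⊤)
open import Data.Sum using (_⊎_)
open import Relation.Nullary using (¬_)
open import Relation.Binary.PropositionalEquality using (_≡_; _≢_)
open import Function.Bundles using (_⇔_)

-- A finite simple graph on vertex set Fin n with a given split partition:
-- inK v ≡ true means v ∈ K, inK v ≡ false means v ∈ I.
record SplitGraph (n : ℕ) : Set where
  field
    adj        : Fin n → Fin n → Bool
    adj-sym    : ∀ u v → adj u v ≡ adj v u
    adj-irrefl : ∀ v → adj v v ≡ false
    inK        : Fin n → Bool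
    K-clique   : ∀ u v → inK u ≡ true → inK v ≡ true → u ≢ v → adj u v ≡ true
    I-indep    : ∀ u v → inK u ≡ false → inK v ≡ false → adj u v ≡ false

open SplitGraph public

VSet : ℕ → Set₁
VSet n = Fin n → Set

module _ {n : ℕ} (G : SplitGraph n) where

  -- v is simplicial in G minus the vertices of the list R:
  -- any two distinct neighbours of v outside R are adjacent.
  Simplicial : List (Fin n) → Fin n → Set
  Simplicial R v = ∀ u w → ¬ (u ∈ˡ R) → ¬ (w ∈ˡ R) →
                   adj G v u ≡ true → adj G v w ≡ true → u ≢ w → adj G u w ≡ true

  -- (f₁ , … , fₘ) is a shelling sequence after the vertices of `done`
  -- have been removed: each fⱼ is a not-yet-removed vertex, simplicial in
  -- the graph with `done` and f₁,…,fⱼ₋₁ removed.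
  IsShelling : List (Fin n) → List (Fin n) → Set
  IsShelling done []       = ⊤
  IsShelling done (x ∷ xs) = ¬ (x ∈ˡ done) × Simplicial done x × IsShelling (x ∷ done) xs

  Feasible : VSet n → Set
  Feasible F = Σ (List (Fin n)) λ xs → IsShelling [] xs × (∀ v → F v ⇔ (v ∈ˡ xs))

  InNbhd : VSet n → Fin n → Set
  InNbhd S v = ¬ S v × ∃ λ u → S u × adj G u v ≡ true

  IFeasible : Fin n → VSet n → Set
  IFeasible i F = Feasible F × InNbhd F i

  InFos : Fin n → Fin n → Set
  InFos i v =
      (inK G v ≡ true × adj G v i ≡ false)
    ⊎ (inK G v ≡ false × ∃ λ x → adj G v x ≡ true × adj G i x ≡ false)

module Submission where

-- Let F be i-feasible: a shelling sequence xs removes F, never removes i,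
-- but removes a neighbour u of i; u lies in K because I is independent.
-- The whole argument rests on one fact about shelling sequences: a vertex is
-- simplicial at the moment it is removed, i.e. in the graph from which only the
-- vertices removed before it are deleted (`at-removal`).  In particular two
-- distinct neighbours of a removed vertex that are never removed are adjacent
-- (`survivors-adjacent`).  Now let v ∈ fos(i) and suppose v ∉ F.
--   * v ∈ K, v ≁ i : v and i survive and are neighbours of u, so v ∼ i.
--   * v ∈ I, v ∼ x ≁ i : x ∈ K.  If x is still present when u is removed then
--     x ∼ i, as x and i are neighbours of u.  Otherwise x was removed before u,
--     while u and v were present, so u ∼ v; then v and i are surviving
--     neighbours of u, hence v ∼ i, contradicting independence of I.

open import Defs
open import Data.Nat using (ℕ)
open import Data.Fin using (Fin; _≟_)
open import Data.Bool using (Bool; true; false)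
open import Data.List using (List; []; _∷_; _++_; _ʳ++_; reverse)
open import Data.List.Membership.Propositional using (_∈_)
open import Data.List.Membership.Propositional.Properties using (∈-∃++; ∈-++⁺ˡ)
open import Data.List.Relation.Unary.Any.Properties using (reverse⁺; reverse⁻)
open import Data.Product using (_×_; _,_; proj₂)
open import Data.Sum using (inj₁; inj₂)
open import Data.Unit using (tt)
open import Data.Empty using (⊥; ⊥-elim)
open import Function using (_∘_)
open import Function.Bundles using (Equivalence)
open import Relation.Nullary using (¬_; yes; no)
open import Relation.Binary.PropositionalEquality using (_≡_; refl; trans; _≢_)

clash : ∀ {b : Bool} → b ≡ true → b ≡ false → ⊥
clash refl ()

separated : ∀ {n} (test : Fin n → Bool) {a b : Fin n} →
            test a ≡ true → test b ≡ false → a ≢ b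
separated test ta tb refl = clash ta tb

module SplitShelling {n : ℕ} (G : SplitGraph n) where

  open import Data.List.Membership.DecPropositional (_≟_ {n}) using (_∈?_)

  flip-adj : ∀ {a b} {β : Bool} → adj G a b ≡ β → adj G b a ≡ β
  flip-adj {a} {b} eq = trans (adj-sym G b a) eq

  neighbour-of-I : ∀ {u i} → inK G i ≡ false → adj G u i ≡ true → inK G u ≡ true
  neighbour-of-I {u} {i} Ii aui with inK G u in Ku
  ... | true  = refl
  ... | false = ⊥-elim (clash aui (I-indep G u i Ku Ii))

  shelling-suffix : ∀ done pre {ys} → IsShelling G done (pre ++ ys) →
                    IsShelling G (pre ʳ++ done) ys
  shelling-suffix done []        sh           = sh
  shelling-suffix done (p ∷ pre) (_ , _ , sh) = shelling-suffix (p ∷ done) pre sh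

  shelling-prefix : ∀ done pre {ys} → IsShelling G done (pre ++ ys) →
                    IsShelling G done pre
  shelling-prefix done []        _             = tt
  shelling-prefix done (p ∷ pre) (np , sp , sh) = np , sp , shelling-prefix (p ∷ done) pre sh

  at-removal : ∀ done pre {w post} → IsShelling G done (pre ++ w ∷ post) →
               ¬ w ∈ pre ʳ++ done × Simplicial G (pre ʳ++ done) w
  at-removal done pre sh with nw , sw , _ ← shelling-suffix done pre sh = nw , sw

  removed-before : ∀ (pre : List (Fin n)) {ys c} → c ∈ reverse pre → c ∈ pre ++ ys
  removed-before pre c∈ = ∈-++⁺ˡ {xs = pre} (reverse⁻ {xs = pre} c∈)

  survivors-adjacent : ∀ {xs w a b} → IsShelling G [] xs → w ∈ xs →
                       ¬ a ∈ xs → ¬ b ∈ xs →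
                       adj G w a ≡ true → adj G w b ≡ true → a ≢ b → adj G a b ≡ true
  survivors-adjacent {a = a} {b} sh w∈xs a∉xs b∉xs
    with pre , post , refl ← ∈-∃++ w∈xs =
    proj₂ (at-removal [] pre sh) a b (a∉xs ∘ removed-before pre) (b∉xs ∘ removed-before pre)

  module _ {i u xs} (Ii : inK G i ≡ false) (sh : IsShelling G [] xs)
           (u∈xs : u ∈ xs) (aui : adj G u i ≡ true) (i∉xs : ¬ i ∈ xs) where

    Ku : inK G u ≡ true
    Ku = neighbour-of-I Ii aui

    -- fos(i) ∩ K: a surviving v ∈ K with v ≁ i is a neighbour of u, as is i.
    K-part-removed : ∀ {v} → inK G v ≡ true → adj G v i ≡ false → ¬ ¬ v ∈ xs
    K-part-removed {v} Kv avi v∉xs =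
      clash (survivors-adjacent sh u∈xs v∉xs i∉xs auv aui v≢i) avi
      where
        auv : adj G u v ≡ true
        auv = K-clique G u v Ku Kv (separated (λ w → adj G w i) aui avi)
        v≢i : v ≢ i
        v≢i = separated (inK G) Kv Ii

    module _ {v x} (Iv : inK G v ≡ false) (avx : adj G v x ≡ true)
             (aix : adj G i x ≡ false) where

      Kx : inK G x ≡ true
      Kx = neighbour-of-I Iv (flip-adj avx)

      aux : adj G u x ≡ true
      aux = K-clique G u x Ku Kx (separated (λ w → adj G w i) aui (flip-adj aix))

      I-part-removed : ¬ ¬ v ∈ xs
      I-part-removed v∉xs
        with pre , post , refl ← ∈-∃++ u∈xs
        with at-removal [] pre sh | x ∈? pre
      ... | _ , u-simplicial | no x∉pre =
        clash (u-simplicial x i (x∉pre ∘ reverse⁻) (i∉xs ∘ removed-before pre) aux aui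
                 (separated (inK G) Kx Ii))
              (flip-adj aix)
      ... | u∉removed , _ | yes x∈pre =
        clash (survivors-adjacent sh u∈xs v∉xs i∉xs auv aui v≢i) (I-indep G v i Iv Ii)
        where
          -- x was removed while u and v were both present.
          auv : adj G u v ≡ true
          auv = survivors-adjacent (shelling-prefix [] pre sh) x∈pre
                  (u∉removed ∘ reverse⁺) (v∉xs ∘ ∈-++⁺ˡ) (flip-adj aux) (flip-adj avx)
                  (separated (inK G) Ku Iv)
          v≢i : v ≢ i
          v≢i = separated (λ w → adj G w x) avx aix

    fos-removed : ∀ {v} → InFos G i v → v ∈ xs
    fos-removed {v} fos with v ∈? xs | fos
    ... | yes v∈xs | _                         = v∈xs
    ... | no v∉xs  | inj₁ (Kv , avi)           = ⊥-elim (K-part-removed Kv avi v∉xs)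
    ... | no v∉xs  | inj₂ (Iv , x , avx , aix) = ⊥-elim (I-part-removed Iv avx aix v∉xs)

mainTheorem7 : ∀ {n : ℕ} (G : SplitGraph n) (i : Fin n) → inK G i ≡ false →
               ∀ (F : VSet n) → IFeasible G i F →
               ∀ v → InFos G i v → F v
mainTheorem7 G i Ii F ((xs , sh , F⇔xs) , (i∉F , u , u∈F , aui)) v v∈fos =
  from (F⇔xs v) (fos-removed Ii sh (to (F⇔xs u) u∈F) aui (i∉F ∘ from (F⇔xs i)) v∈fos)
  where
    open Equivalence
    open SplitShelling G
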